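{- Let $(W,R)$, $w_0$, $\Gamma$, $N$, $\mathcal{J}$ be as in the context, suppose $(W,R)$ is an impossibility frame under $\Gamma$, and let $F:\mathcal{J}^N\to\mathcal{J}$ satisfy Unanimity and Positive-Negative Neutrality. Then for all negation-free $\Phi,\Psi\in\Gamma$ with $\Phi<_0\Psi$, and all $A\subseteq B\subseteq N$: if $A\in\mathcal{U}_\Phi$ then $B\in\mathcal{U}_\Psi$.
   Context: Fix integers $r>k\ge1$ and nonempty $A_0\subseteq\mathbb{Z}/r\mathbb{Z}$. Frame 1: $W=\{x\}\sqcup\mathbb{Z}/r\mathbb{Z}$, $R=\{(x,a)\mid a\in A_0\}\sqcup\{(w,w+k)\}$; Frame 2: $W=\mathbb{Z}/r\mathbb{Z}$, $R=\{(w,w+a)\mid a\in A_0\}$. $(W,R)$ is Frame 1 or 2; $w_0\in W$ fixed. Formulas from one variable $p$ with $\Box,\Diamond,\lnot$, standard Kripke semantics, $\lnot\lnot\Phi=\Phi$. $\Gamma$ is $\{\Box^jp,\lnot\Box^jp\}_{j\ge1}$ or $\{(\Box\Diamond)^j\Box p,\lnot(\Box\Diamond)^j\Box p\}_{j\ge0}$. Consistent: some $V\subseteq W$ makes all members true at $w_0$; complete: contains $\Phi$ or $\lnot\Phi$ for each $\Phi\in\Gamma$; $\mathcal{J}$ = rational (complete and consistent) subsets. $N=\{1,\dots,n\}$, $n\ge2$; profiles $f\in\mathcal{J}^N$, $f^{ -1}(\Phi)=\{i\mid\Phi\in f(i)\}$. Unanimity: $f^{ -1}(\Phi)=N\Rightarrow\Phi\in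 F(f)$. Positive-Negative Neutrality: $f^{ -1}(\Phi)=g^{ -1}(\lnot\Phi)\Rightarrow(\Phi\in F(f)\Leftrightarrow\lnot\Phi\in F(g))$. $\mathcal{U}_\Phi=\{A\subseteq N\mid \forall f\in\mathcal{J}^N,\ f^{ -1}(\Phi)=A\Rightarrow\Phi\in F(f)\}$. Minimally inconsistent: $\Delta\subseteq\Gamma$ such that for all $\Delta_0\subseteq\Delta$, $\Delta_0$ inconsistent iff $\Delta_0=\Delta$. $\Phi<_0\Psi$ (negation-free): some $\Gamma_0\subseteq\Gamma$ with $\Gamma_0\cup\{\Phi,\lnot\Psi\}$ minimally inconsistent and $\Gamma_0\cup\{\lnot\Phi,\Psi\}$ consistent. Impossibility frame: some minimally inconsistent subset of $\Gamma$ has at least 3 elements, and for all negation-free $\Phi,\Psi\in\Gamma$ there is a chain $\Phi=\Phi_0<_0\Phi_1<_0\dots<_0\Phi_m=\Psi$. -}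

module Defs where

open import Data.Bool using (Bool; true; false; _∨_)
open import Data.Nat using (ℕ; zero; suc; _+_)
open import Data.Nat.DivMod using (_mod_)
open import Data.Fin using (Fin; toℕ)
open import Data.Fin.Subset using (Subset)
open import Data.Vec using (tabulate)
open import Data.Unit using (⊤; tt)
open import Data.Empty using (⊥)
open import Data.Sum using (_⊎_; inj₁; inj₂)
open import Data.Product using (Σ; _×_; _,_; proj₁; ∃)
open import Relation.Nullary using (¬_)
open import Relation.Binary.PropositionalEquality using (_≡_; _≢_)
open import Relation.Binary.Construct.Closure.ReflexiveTransitive using (Star)
import Data.Fin.Subset as Sub

data Fm : Set where
  p   : Fm
  ~_  : Fm → Fm
  □_  : Fm → Fm
  ◇_  : Fm → Fm

-- V ⊆ W is represented by its characteristic function V : W → Bool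
Sat : {W : Set} (R : W → W → Set) (V : W → Bool) → W → Fm → Set
Sat R V w p       = V w ≡ true
Sat R V w (~ φ)   = ¬ Sat R V w φ
Sat R V w (□ φ)   = ∀ v → R w v → Sat R V v φ
Sat R V w (◇ φ)   = Σ _ λ v → R w v × Sat R V v φ

data FrameChoice : Set where
  frame1 frame2 : FrameChoice

shift : ∀ {r} → Fin r → ℕ → Fin r
shift {suc r} w m = (toℕ w + m) mod (suc r)

-- Frame 1: W = {x} ⊔ ℤ/rℤ (x = inj₁ tt); Frame 2: W = ℤ/rℤ
World : FrameChoice → ℕ → Set
World frame1 r = ⊤ ⊎ Fin r
World frame2 r = Fin r

Rel : (fc : FrameChoice) (r k : ℕ) (A0 : Subset r) → World fc r → World fc r → Set
Rel frame1 r k A0 (inj₁ _) (inj₁ _) = ⊥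
Rel frame1 r k A0 (inj₁ _) (inj₂ a) = a Sub.∈ A0
Rel frame1 r k A0 (inj₂ w) (inj₁ _) = ⊥
Rel frame1 r k A0 (inj₂ w) (inj₂ v) = v ≡ shift w k
Rel frame2 r k A0 w v = Σ (Fin r) λ a → a Sub.∈ A0 × v ≡ shift w (toℕ a)

data GammaChoice : Set where
  gammaBox   : GammaChoice
  gammaBoxDia : GammaChoice

boxN : ℕ → Fm → Fm
boxN zero φ = φ
boxN (suc j) φ = □ (boxN j φ)

bdN : ℕ → Fm → Fm
bdN zero φ = φ
bdN (suc j) φ = □ (◇ (bdN j φ))

-- negation-free member of Γ with index j
-- (gammaBox: index j stands for □^(j+1) p, since j ≥ 1 there)
base : GammaChoice → ℕ → Fm
base gammaBox j    = boxN (suc j) p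
base gammaBoxDia j = bdN j (□ p)

data Sign : Set where
  pos neg : Sign

GE : Set
GE = Sign × ℕ

fm : GammaChoice → GE → Fm
fm gc (pos , j) = base gc j
fm gc (neg , j) = ~ base gc j

negGE : GE → GE
negGE (pos , j) = (neg , j)
negGE (neg , j) = (pos , j)

eqSign : Sign → Sign → Bool
eqSign pos pos = true
eqSign neg neg = true
eqSign _ _ = false

eqℕ : ℕ → ℕ → Bool
eqℕ zero zero = true
eqℕ (suc m) (suc n) = eqℕ m n
eqℕ _ _ = false

eqGE : GE → GE → Bool
eqGE (s , m) (t , n) with eqSign s t
... | true = eqℕ m n
... | false = false

SubΓ : Set
SubΓ = GE → Bool

_∈Γ_ : GE → SubΓ → Set
g ∈Γ S = S g ≡ true

_⊆Γ_ : SubΓ → SubΓ → Set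
S ⊆Γ T = ∀ g → g ∈Γ S → g ∈Γ T

_≐Γ_ : SubΓ → SubΓ → Set
S ≐Γ T = ∀ g → S g ≡ T g

_∪₂_,_ : SubΓ → GE → GE → SubΓ
(S ∪₂ a , b) g = S g ∨ eqGE g a ∨ eqGE g b

record Setting : Set where
  field
    r k   : ℕ
    A0    : Subset r
    frame : FrameChoice
    w0    : World frame r
    gamma : GammaChoice

module _ (S : Setting) where
  open Setting S

  Consistent : SubΓ → Set
  Consistent Δ = Σ (World frame r → Bool) λ V →
    ∀ g → g ∈Γ Δ → Sat (Rel frame r k A0) V w0 (fm gamma g)

  Complete : SubΓ → Set
  Complete Δ = ∀ j → (pos , j) ∈Γ Δ ⊎ (neg , j) ∈Γ Δ

  Rational : SubΓ → Set
  Rational Δ = Complete Δ × Consistent Δ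

  𝒥 : Set
  𝒥 = Σ SubΓ Rational

  MinInconsistent : SubΓ → Set
  MinInconsistent Δ = ∀ Δ0 → Δ0 ⊆Γ Δ →
    ((¬ Consistent Δ0 → Δ0 ≐Γ Δ) × (Δ0 ≐Γ Δ → ¬ Consistent Δ0))

  AtLeast3 : SubΓ → Set
  AtLeast3 Δ = Σ GE λ a → Σ GE λ b → Σ GE λ c →
    a ∈Γ Δ × b ∈Γ Δ × c ∈Γ Δ × a ≢ b × a ≢ c × b ≢ c

  Lt0 : ℕ → ℕ → Set
  Lt0 i j = Σ SubΓ λ Γ0 →
    MinInconsistent (Γ0 ∪₂ (pos , i) , (neg , j)) ×
    Consistent (Γ0 ∪₂ (neg , i) , (pos , j))

  ImpossibilityFrame : Set
  ImpossibilityFrame =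
    (Σ SubΓ λ Δ → MinInconsistent Δ × AtLeast3 Δ) ×
    (∀ i j → Star Lt0 i j)

  module _ (n : ℕ) where
    Profile : Set
    Profile = Fin n → 𝒥

    Aggregator : Set
    Aggregator = Profile → 𝒥

    preimage : Profile → GE → Subset n
    preimage f g = tabulate λ i → proj₁ (f i) g

    Unanimity : Aggregator → Set
    Unanimity F = ∀ f g → preimage f g ≡ tabulate (λ _ → true) → g ∈Γ proj₁ (F f)

    PNNeutrality : Aggregator → Set
    PNNeutrality F = ∀ f f' g → preimage f g ≡ preimage f' (negGE g) →
      (g ∈Γ proj₁ (F f) → negGE g ∈Γ proj₁ (F f')) ×
      (negGE g ∈Γ proj₁ (F f') → g ∈Γ proj₁ (F f))

    InU : Aggregator → GE → Subset n → Set
    InU F g A = ∀ f → preimage f g ≡ A → g ∈Γ proj₁ (F f)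

-- Write Γ₀ for the witness of Φᵢ <₀ Φⱼ. Minimality of the inconsistency of
-- Γ₀ ∪ {Φᵢ, ¬Φⱼ} makes Γ₀ ∪ {Φᵢ} and Γ₀ ∪ {¬Φⱼ} consistent, and together with
-- the consistency of Γ₀ ∪ {¬Φᵢ, Φⱼ} this realises, by rational judgment sets
-- extending Γ₀, every pair of truth values of (Φᵢ, Φⱼ) except (true, false).
-- Give voters in A, B \ A and N \ B the patterns (1,1), (0,1), (0,0): then Φᵢ
-- is accepted since A ∈ 𝒰_Φᵢ, Γ₀ by unanimity, hence Φⱼ by rationality of the
-- outcome, while exactly B accepts Φⱼ. Neutrality moves this acceptance to
-- every profile in which exactly B accepts Φⱼ, via a profile in which exactly
-- B accepts ¬Φⱼ. The two consistency facts hold only under a double negation,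
-- which suffices because acceptance of Φⱼ by F is a Boolean fact.
module Submission where

open import Defs
open import Data.Bool using (Bool; true; false; not)
open import Data.Bool.Properties using (¬-not; not-involutive) renaming (_≟_ to _≟ᵇ_)
open import Data.Fin using (toℕ)
import Data.Fin.Properties as Fin
open import Data.Fin.Subset using (Subset; _⊆_; Nonempty)
open import Data.Fin.Subset.Properties using (_∈?_)
open import Data.Nat using (ℕ; zero; suc; _≤_; _<_)
open import Data.Product using (Σ; _×_; _,_; proj₁; proj₂)
open import Data.Sum using (_⊎_; inj₁; inj₂; [_,_]′)
import Data.Sum as Sum
open import Data.Unit using (tt)
open import Data.Vec using (lookup)
open import Data.Vec.Properties using (tabulate-cong; tabulate∘lookup; lookup⇒[]=; []=⇒lookup)
open import Effect.Monad using (RawMonad)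
open import Function using (id)
open import Relation.Nullary using (Dec; yes; no; does; ¬_; contradiction)
open import Relation.Nullary.Decidable using (_×-dec_; _→-dec_; ¬?; toSum; dec-true; decidable-stable)
open import Relation.Nullary.Negation using (¬¬-Monad; ¬¬-map)
open import Relation.Binary.PropositionalEquality using (_≡_; _≢_; refl; sym; trans; cong)

World-all? : ∀ fc {r} {P : World fc r → Set} → (∀ w → Dec (P w)) → Dec (∀ w → P w)
World-all? frame1 P? with P? (inj₁ tt) | Fin.all? (λ a → P? (inj₂ a))
... | yes Px | yes Pa = yes λ { (inj₁ tt) → Px ; (inj₂ a) → Pa a }
... | no ¬Px | _      = no λ P → ¬Px (P (inj₁ tt))
... | _      | no ¬Pa = no λ P → ¬Pa (λ a → P (inj₂ a))
World-all? frame2 P? = Fin.all? P?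

World-any? : ∀ fc {r} {P : World fc r → Set} → (∀ w → Dec (P w)) → Dec (Σ (World fc r) P)
World-any? frame1 P? with P? (inj₁ tt) | Fin.any? (λ a → P? (inj₂ a))
... | yes Px | _            = yes (inj₁ tt , Px)
... | _      | yes (a , Pa) = yes (inj₂ a , Pa)
... | no ¬Px | no ¬Pa       = no λ { (inj₁ tt , Px) → ¬Px Px ; (inj₂ a , Pa) → ¬Pa (a , Pa) }
World-any? frame2 P? = Fin.any? P?

Rel? : ∀ fc r k A0 (w v : World fc r) → Dec (Rel fc r k A0 w v)
Rel? frame1 r k A0 (inj₁ _) (inj₁ _) = no λ ()
Rel? frame1 r k A0 (inj₁ _) (inj₂ a) = a ∈? A0
Rel? frame1 r k A0 (inj₂ w) (inj₁ _) = no λ ()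
Rel? frame1 r k A0 (inj₂ w) (inj₂ v) = v Fin.≟ shift w k
Rel? frame2 r k A0 w v = Fin.any? λ a → (a ∈? A0) ×-dec (v Fin.≟ shift w (toℕ a))

Sat? : ∀ fc r k A0 (V : World fc r → Bool) w φ → Dec (Sat (Rel fc r k A0) V w φ)
Sat? fc r k A0 V w p     = V w ≟ᵇ true
Sat? fc r k A0 V w (~ φ) = ¬? (Sat? fc r k A0 V w φ)
Sat? fc r k A0 V w (□ φ) = World-all? fc λ v → Rel? fc r k A0 w v →-dec Sat? fc r k A0 V v φ
Sat? fc r k A0 V w (◇ φ) = World-any? fc λ v → Rel? fc r k A0 w v ×-dec Sat? fc r k A0 V v φ

eqℕ⇒≡ : ∀ m n → eqℕ m n ≡ true → m ≡ n
eqℕ⇒≡ zero    zero    _ = refl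
eqℕ⇒≡ (suc m) (suc n) e = cong suc (eqℕ⇒≡ m n e)

eqℕ-refl : ∀ n → eqℕ n n ≡ true
eqℕ-refl zero    = refl
eqℕ-refl (suc n) = eqℕ-refl n

eqGE⇒≡ : ∀ g h → eqGE g h ≡ true → g ≡ h
eqGE⇒≡ (pos , m) (pos , n) e = cong (pos ,_) (eqℕ⇒≡ m n e)
eqGE⇒≡ (neg , m) (neg , n) e = cong (neg ,_) (eqℕ⇒≡ m n e)

eqGE-refl : ∀ g → eqGE g g ≡ true
eqGE-refl (pos , n) = eqℕ-refl n
eqGE-refl (neg , n) = eqℕ-refl n

module _ (X : SubΓ) (a b : GE) where

  ∈-∪₂⁻ : ∀ g → g ∈Γ (X ∪₂ a , b) → g ∈Γ X ⊎ g ≡ a ⊎ g ≡ b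
  ∈-∪₂⁻ g e with X g | eqGE g a in ga | eqGE g b in gb
  ... | true  | _    | _    = inj₁ refl
  ... | false | true | _    = inj₂ (inj₁ (eqGE⇒≡ g a ga))
  ... | false | false | true = inj₂ (inj₂ (eqGE⇒≡ g b gb))

  ⊆-∪₂ : X ⊆Γ (X ∪₂ a , b)
  ⊆-∪₂ g e rewrite e = refl

  ∈-∪₂-first : a ∈Γ (X ∪₂ a , b)
  ∈-∪₂-first with X a
  ... | true  = refl
  ... | false rewrite eqGE-refl a = refl

  ∈-∪₂-second : b ∈Γ (X ∪₂ a , b)
  ∈-∪₂-second with X b | eqGE b a
  ... | true  | _     = refl
  ... | false | true  = refl
  ... | false | false = eqGE-refl b

  ∪₂-least : ∀ {T} → X ⊆Γ T → a ∈Γ T → b ∈Γ T → (X ∪₂ a , b) ⊆Γ T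
  ∪₂-least X⊆T a∈T b∈T g e with ∈-∪₂⁻ g e
  ... | inj₁ g∈X          = X⊆T g g∈X
  ... | inj₂ (inj₁ refl) = a∈T
  ... | inj₂ (inj₂ refl) = b∈T

  ∉-∪₂ : ∀ g → ¬ g ∈Γ X → g ≢ a → g ≢ b → ¬ g ∈Γ (X ∪₂ a , b)
  ∉-∪₂ g g∉X g≢a g≢b e = [ g∉X , [ g≢a , g≢b ]′ ]′ (∈-∪₂⁻ g e)

module _ (S : Setting) where
  open Setting S

  Valuation : Set
  Valuation = World frame r → Bool

  infix 4 _⊨_ _⊨?_

  _⊨_ : Valuation → GE → Set
  V ⊨ g = Sat (Rel frame r k A0) V w0 (fm gamma g)

  _⊨?_ : ∀ V g → Dec (V ⊨ g)
  V ⊨? g = Sat? frame r k A0 V w0 (fm gamma g)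

  theory : Valuation → SubΓ
  theory V g = does (V ⊨? g)

  ∈-theory : ∀ {V} g → V ⊨ g → g ∈Γ theory V
  ∈-theory {V} g = dec-true (V ⊨? g)

  ⊨-theory : ∀ {V} g → g ∈Γ theory V → V ⊨ g
  ⊨-theory {V} g e with V ⊨? g | e
  ... | yes s | _ = s
  ... | no _  | ()

  theory-rational : ∀ V → Rational S (theory V)
  theory-rational V = complete , V , ⊨-theory
    where
    complete : Complete S (theory V)
    complete j = Sum.map (∈-theory (pos , j)) (∈-theory (neg , j)) (toSum (V ⊨? (pos , j)))

  Consistent-antitone : ∀ {Δ Δ′} → Δ′ ⊆Γ Δ → Consistent S Δ → Consistent S Δ′
  Consistent-antitone Δ′⊆Δ (V , sat) = V , λ g e → sat g (Δ′⊆Δ g e)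

  Consistent⇒rational-extension : ∀ {Δ} → Consistent S Δ → Σ (𝒥 S) λ J → Δ ⊆Γ proj₁ J
  Consistent⇒rational-extension (V , sat) = (theory V , theory-rational V) , λ g e → ∈-theory g (sat g e)

  Consistent⇒¬pos-neg : ∀ {Δ j} → Consistent S Δ → (pos , j) ∈Γ Δ → ¬ (neg , j) ∈Γ Δ
  Consistent⇒¬pos-neg (V , sat) pos∈ neg∈ = sat _ neg∈ (sat _ pos∈)

  Consistent-neg⇒pos-false : ∀ {Δ j} → Consistent S Δ → (neg , j) ∈Γ Δ → Δ (pos , j) ≡ false
  Consistent-neg⇒pos-false c neg∈ = ¬-not λ pos∈ → Consistent⇒¬pos-neg c pos∈ neg∈

  rational-neg : ∀ {Δ} → Rational S Δ → ∀ j → Δ (neg , j) ≡ not (Δ (pos , j))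
  rational-neg (complete , c) j = ¬-not λ same →
    [ (λ pos∈ → Consistent⇒¬pos-neg c pos∈ (trans same pos∈))
    , (λ neg∈ → Consistent⇒¬pos-neg c (trans (sym same) neg∈) neg∈) ]′ (complete j)

  MinInconsistent⇒inconsistent : ∀ {Δ} → MinInconsistent S Δ → ¬ Consistent S Δ
  MinInconsistent⇒inconsistent mi = proj₂ (mi _ λ _ e → e) λ _ → refl

  MinInconsistent⇒¬¬Consistent : ∀ {Δ} → MinInconsistent S Δ → ∀ {Δ′ g} → Δ′ ⊆Γ Δ →
    g ∈Γ Δ → ¬ g ∈Γ Δ′ → ¬ ¬ Consistent S Δ′
  MinInconsistent⇒¬¬Consistent mi Δ′⊆Δ g∈Δ g∉Δ′ inc =
    g∉Δ′ (trans (proj₁ (mi _ Δ′⊆Δ) inc _) g∈Δ)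

  inconsistent⇒rational-closed : ∀ {Γ0 i j} → ¬ Consistent S (Γ0 ∪₂ (pos , i) , (neg , j)) →
    ∀ {Δ} → Rational S Δ → Γ0 ⊆Γ Δ → (pos , i) ∈Γ Δ → (pos , j) ∈Γ Δ
  inconsistent⇒rational-closed {Γ0} {i} {j} inc (complete , c) Γ0⊆Δ pi with complete j
  ... | inj₁ pj = pj
  ... | inj₂ nj = contradiction (Consistent-antitone (∪₂-least Γ0 (pos , i) (neg , j) Γ0⊆Δ pi nj) c) inc

  Consistent-∪₂⇒rational-extension : ∀ {Γ0 φ ψ} → Consistent S (Γ0 ∪₂ φ , ψ) →
    Σ (𝒥 S) λ J → Γ0 ⊆Γ proj₁ J × φ ∈Γ proj₁ J × ψ ∈Γ proj₁ J
  Consistent-∪₂⇒rational-extension {Γ0} {φ} {ψ} c with Consistent⇒rational-extension c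
  ... | J , Δ⊆J = J , (λ g e → Δ⊆J g (⊆-∪₂ Γ0 φ ψ g e))
                    , Δ⊆J φ (∈-∪₂-first Γ0 φ ψ) , Δ⊆J ψ (∈-∪₂-second Γ0 φ ψ)

  record Extension (Γ0 : SubΓ) (i j : ℕ) (a b : Bool) : Set where
    field
      J       : 𝒥 S
      extends : Γ0 ⊆Γ proj₁ J
      value-i : proj₁ J (pos , i) ≡ a
      value-j : proj₁ J (pos , j) ≡ b

  module _ {i j : ℕ} (lt : Lt0 S i j) where

    private
      Γ0 : SubΓ
      Γ0 = proj₁ lt

      minimal : MinInconsistent S (Γ0 ∪₂ (pos , i) , (neg , j))
      minimal = proj₁ (proj₂ lt)

      consistent : Consistent S (Γ0 ∪₂ (neg , i) , (pos , j))
      consistent = proj₂ (proj₂ lt)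

    Lt0⇒rational-closed : ∀ {Δ} → Rational S Δ → Γ0 ⊆Γ Δ → (pos , i) ∈Γ Δ → (pos , j) ∈Γ Δ
    Lt0⇒rational-closed = inconsistent⇒rational-closed (MinInconsistent⇒inconsistent minimal)

    neg-j∉Γ0 : ¬ (neg , j) ∈Γ Γ0
    neg-j∉Γ0 nj = Consistent⇒¬pos-neg consistent
      (∈-∪₂-second Γ0 (neg , i) (pos , j)) (⊆-∪₂ Γ0 (neg , i) (pos , j) _ nj)

    pos-i∉Γ0 : ¬ (pos , i) ∈Γ Γ0
    pos-i∉Γ0 pi = Consistent⇒¬pos-neg consistent
      (⊆-∪₂ Γ0 (neg , i) (pos , j) _ pi) (∈-∪₂-first Γ0 (neg , i) (pos , j))

    -- Γ₀ ∪ {φ} is encoded as Γ₀ ∪₂ φ , φ.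
    Γ0∪₂φ⊆Γ0∪₂i,¬j : ∀ φ → φ ∈Γ (Γ0 ∪₂ (pos , i) , (neg , j)) →
      (Γ0 ∪₂ φ , φ) ⊆Γ (Γ0 ∪₂ (pos , i) , (neg , j))
    Γ0∪₂φ⊆Γ0∪₂i,¬j φ φ∈ = ∪₂-least Γ0 φ φ (⊆-∪₂ Γ0 (pos , i) (neg , j)) φ∈ φ∈

    Lt0⇒¬¬Consistent-i : ¬ ¬ Consistent S (Γ0 ∪₂ (pos , i) , (pos , i))
    Lt0⇒¬¬Consistent-i = MinInconsistent⇒¬¬Consistent minimal
      (Γ0∪₂φ⊆Γ0∪₂i,¬j (pos , i) (∈-∪₂-first Γ0 (pos , i) (neg , j)))
      (∈-∪₂-second Γ0 (pos , i) (neg , j))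
      (∉-∪₂ Γ0 (pos , i) (pos , i) (neg , j) neg-j∉Γ0 (λ ()) λ ())

    Lt0⇒¬¬Consistent-¬j : ¬ ¬ Consistent S (Γ0 ∪₂ (neg , j) , (neg , j))
    Lt0⇒¬¬Consistent-¬j = MinInconsistent⇒¬¬Consistent minimal
      (Γ0∪₂φ⊆Γ0∪₂i,¬j (neg , j) (∈-∪₂-second Γ0 (pos , i) (neg , j)))
      (∈-∪₂-first Γ0 (pos , i) (neg , j))
      (∉-∪₂ Γ0 (neg , j) (neg , j) (pos , i) pos-i∉Γ0 (λ ()) λ ())

    extension-true-true : Consistent S (Γ0 ∪₂ (pos , i) , (pos , i)) → Extension Γ0 i j true true
    extension-true-true c with Consistent-∪₂⇒rational-extension c
    ... | J , Γ0⊆J , pi , _ = record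
      { J = J ; extends = Γ0⊆J ; value-i = pi ; value-j = Lt0⇒rational-closed (proj₂ J) Γ0⊆J pi }

    extension-false-false : Consistent S (Γ0 ∪₂ (neg , j) , (neg , j)) → Extension Γ0 i j false false
    extension-false-false c with Consistent-∪₂⇒rational-extension c
    ... | J , Γ0⊆J , nj , _ = record
      { J = J ; extends = Γ0⊆J
      ; value-i = ¬-not λ pi →
          Consistent⇒¬pos-neg (proj₂ (proj₂ J)) (Lt0⇒rational-closed (proj₂ J) Γ0⊆J pi) nj
      ; value-j = Consistent-neg⇒pos-false (proj₂ (proj₂ J)) nj }

    extension-false-true : Extension Γ0 i j false true
    extension-false-true with Consistent-∪₂⇒rational-extension consistent
    ... | J , Γ0⊆J , ni , pj = record
      { J = J ; extends = Γ0⊆J ; value-i = Consistent-neg⇒pos-false (proj₂ (proj₂ J)) ni ; value-j = pj }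

    Lt0⇒¬¬extensions : ¬ ¬ (∀ a b → (a ≡ true → b ≡ true) → Extension Γ0 i j a b)
    Lt0⇒¬¬extensions = do
      consistent-i ← Lt0⇒¬¬Consistent-i
      consistent-¬j ← Lt0⇒¬¬Consistent-¬j
      pure λ where
        true  true  _   → extension-true-true consistent-i
        false false _   → extension-false-false consistent-¬j
        false true  _   → extension-false-true
        true  false t⇒f → contradiction (t⇒f refl) λ ()
      where open RawMonad ¬¬-Monad

  module _ {n : ℕ} where

    preimage-lookup : ∀ (f : Profile S n) g (A : Subset n) →
      (∀ x → proj₁ (f x) g ≡ lookup A x) → preimage S n f g ≡ A
    preimage-lookup f g A f≗A = trans (tabulate-cong f≗A) (tabulate∘lookup A)

    InU-stable : ∀ {F g} (B : Subset n) → ¬ ¬ InU S n F g B → InU S n F g B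
    InU-stable {F} {g} B ¬¬u f pf =
      decidable-stable (proj₁ (F f) g ≟ᵇ true) λ g∉Ff → ¬¬u λ u → g∉Ff (u f pf)

    PNNeutrality⇒InU : ∀ {F} → PNNeutrality S n F → ∀ {φ B} (f₀ h : Profile S n) →
      preimage S n f₀ φ ≡ B → preimage S n h (negGE φ) ≡ B → φ ∈Γ proj₁ (F f₀) → InU S n F φ B
    PNNeutrality⇒InU neutral {φ} f₀ h f₀φ≡B h¬φ≡B φ∈Ff₀ f fφ≡B =
      proj₂ (neutral f h φ (trans fφ≡B (sym h¬φ≡B)))
        (proj₁ (neutral f₀ h φ (trans f₀φ≡B (sym h¬φ≡B))) φ∈Ff₀)

    InU-upward : ∀ {F Γ0 i j} → Unanimity S n F → PNNeutrality S n F →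
      (∀ {Δ} → Rational S Δ → Γ0 ⊆Γ Δ → (pos , i) ∈Γ Δ → (pos , j) ∈Γ Δ) →
      (∀ a b → (a ≡ true → b ≡ true) → Extension Γ0 i j a b) →
      ∀ {A B} → A ⊆ B → InU S n F (pos , i) A → InU S n F (pos , j) B
    InU-upward {F} {Γ0} {i} {j} unanimous neutral closed extension {A} {B} A⊆B A∈U =
      PNNeutrality⇒InU {F} neutral f₀ h
        (preimage-lookup f₀ _ B (λ x → Extension.value-j (e₀ x)))
        (preimage-lookup h _ B h-neg-j)
        (closed (proj₂ (F f₀)) Γ0⊆Ff₀
          (A∈U f₀ (preimage-lookup f₀ _ A λ x → Extension.value-i (e₀ x))))
      where
      e₀ : ∀ x → Extension Γ0 i j (lookup A x) (lookup B x)
      e₀ x = extension _ _ λ e → []=⇒lookup (A⊆B (lookup⇒[]= x A e))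

      f₀ : Profile S n
      f₀ x = Extension.J (e₀ x)

      Γ0⊆Ff₀ : Γ0 ⊆Γ proj₁ (F f₀)
      Γ0⊆Ff₀ g e = unanimous f₀ g (tabulate-cong λ x → Extension.extends (e₀ x) g e)

      eₕ : ∀ x → Extension Γ0 i j (not (lookup B x)) (not (lookup B x))
      eₕ x = extension _ _ id

      h : Profile S n
      h x = Extension.J (eₕ x)

      h-neg-j : ∀ x → proj₁ (h x) (neg , j) ≡ lookup B x
      h-neg-j x = trans (rational-neg (proj₂ (h x)) j)
                        (trans (cong not (Extension.value-j (eₕ x))) (not-involutive (lookup B x)))

proposition3 : (S : Setting) → 1 ≤ Setting.k S → Setting.k S < Setting.r S →
    Nonempty (Setting.A0 S) → ImpossibilityFrame S →
    (n : ℕ) → 2 ≤ n → (F : Aggregator S n) →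
    Unanimity S n F → PNNeutrality S n F →
    (i j : ℕ) → Lt0 S i j →
    (A B : Subset n) → A ⊆ B →
    InU S n F (pos , i) A → InU S n F (pos , j) B
proposition3 S _ _ _ _ n _ F unanimous neutral i j lt A B A⊆B A∈U =
  InU-stable S {F = F} B (¬¬-map upward (Lt0⇒¬¬extensions S lt))
  where
  upward : (∀ a b → (a ≡ true → b ≡ true) → Extension S (proj₁ lt) i j a b) → InU S n F (pos , j) B
  upward extension = InU-upward S {F = F} unanimous neutral (Lt0⇒rational-closed S lt) extension A⊆B A∈U
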